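{- Let $m\ge2$ and $A=\{p_1,\dots,p_k\}\subseteq\mathbb Z_m\setminus\{0\}$ with $\gcd(p_1,\dots,p_k,m)=1$. For each $x$ in the interior of $C(m;A)$, the point $y=q(x)$ lies in (the relative interior of) a face $F$ of $\mathcal C_m$ with trivial Kunz subgroup, and the Kunz nilsemigroup of $F$ has atom set exactly $A$.
   Context: Fix $m\ge2$. Coordinates of $\mathbb R^{m-1}$ are indexed by the nonzero residues of $\mathbb Z_m$; set $x_0=0$. The Kunz cone $\mathcal C_m\subseteq\mathbb R^{m-1}$ is defined by $x_i+x_j\ge x_{i+j}$ for all nonzero $i,j\in\mathbb Z_m$ with $i+j\ne0$. For a face $F$ of $\mathcal C_m$, its Kunz subgroup is $H=\{0\}\cup\{i:x_i=0\ \forall x\in F\}$; when $H$ is trivial, its Kunz nilsemigroup is $N=\mathbb Z_m\cup\{\infty\}$ with commutative operation in which $\infty$ is nil and $a\oplus b=a+b$ if $x_a+x_b=x_{a+b}$ for all $x\in F$, $a\oplus b=\infty$ otherwise. An atom of $N$ is a nonzero element that is not a sum of two nonzero elements. $C(m;A)=\{x\in\mathbb R^k_{\ge0}: x_i\le c\cdot x \text{ for all } i \text{ and all } c\in\mathbb Z^k_{\ge0}\text{ with } c_1p_1+\cdots+c_kp_k\equiv p_i\bmod m\}$, a rational polyhedral cone in $\mathbb R^k$. The map $q:\mathbb R^k_{\ge0}\to\mathbb R^{m-1}$ is $q(x)_i=\min\{c\cdot x: c\in\mathbb Z^k_{\ge0},\ c_1p_1+\cdots+c_kp_k\equiv i\bmod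 m\}$. -}

module Defs where

open import Level using (0ℓ)
open import Data.Nat as ℕ using (ℕ; zero; suc)
open import Data.Nat.DivMod using (_mod_)
open import Data.Nat.GCD using (gcd)
open import Data.Fin using (Fin; zero; suc; toℕ)
open import Data.Maybe using (Maybe; just; nothing)
open import Data.Product using (Σ; ∃; _×_; _,_)
open import Data.Empty using (⊥)
open import Relation.Nullary using (¬_)
open import Relation.Binary.PropositionalEquality using (_≡_; _≢_)
open import Algebra.Structures using (IsCommutativeRing)
open import Relation.Binary.Structures using (IsTotalOrder)

-- The real numbers, axiomatised as a complete ordered field
-- (agda-stdlib has no reals; every model of this record is ℝ).

record RealField : Set₁ where
  infixl 6 _+_
  infixl 7 _*_
  infix 4 _≤_
  field
    R        : Set
    _≤_      : R → R → Set
    _+_ _*_  : R → R → R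
    -_       : R → R
  infix 8 -_
  field
    0# 1#    : R
    isCommutativeRing : IsCommutativeRing _≡_ _+_ _*_ -_ 0# 1#
    isTotalOrder      : IsTotalOrder _≡_ _≤_
    0≢1      : 0# ≢ 1#
    inverse  : ∀ x → x ≢ 0# → Σ R (λ y → x * y ≡ 1#)
    +-mono   : ∀ {x y} z → x ≤ y → x + z ≤ y + z
    *-nonneg : ∀ {x y} → 0# ≤ x → 0# ≤ y → 0# ≤ x * y
    sup      : (P : R → Set) → Σ R P →
               Σ R (λ b → ∀ x → P x → x ≤ b) →
               Σ R (λ s → (∀ x → P x → x ≤ s) ×
                          (∀ b → (∀ x → P x → x ≤ b) → s ≤ b))

sumℕ : ∀ {k} → (Fin k → ℕ) → ℕ
sumℕ {zero}  f = 0
sumℕ {suc k} f = f zero ℕ.+ sumℕ (λ j → f (suc j))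

gcdAll : ∀ {k} → (Fin k → ℕ) → ℕ → ℕ
gcdAll {zero}  v m = m
gcdAll {suc k} v m = gcd (v zero) (gcdAll (λ j → v (suc j)) m)

_⊕_ : ∀ {n} → Fin (suc n) → Fin (suc n) → Fin (suc n)
_⊕_ {n} i j = (toℕ i ℕ.+ toℕ j) mod (suc n)

Congr : ∀ {n k} → (Fin k → Fin (suc n)) → (Fin k → ℕ) → Fin (suc n) → Set
Congr {n} p c i = (sumℕ (λ j → c j ℕ.* toℕ (p j))) mod (suc n) ≡ i

module _ (ℝ : RealField) where
  open RealField ℝ

  infix 4 _<_
  infixl 6 _-_
  _<_ : R → R → Set
  x < y = x ≤ y × x ≢ y

  _-_ : R → R → R
  x - y = x + (- y)

  sumR : ∀ {k} → (Fin k → R) → R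
  sumR {zero}  f = 0#
  sumR {suc k} f = f zero + sumR (λ j → f (suc j))

  _·_ : ℕ → R → R
  zero  · r = 0#
  suc c · r = r + (c · r)

  dotℕ : ∀ {k} → (Fin k → ℕ) → (Fin k → R) → R
  dotℕ c x = sumR (λ j → c j · x j)

  dot : ∀ {k} → (Fin k → R) → (Fin k → R) → R
  dot a z = sumR (λ j → a j * z j)

  InCmA : ∀ {n k} → (Fin k → Fin (suc n)) → (Fin k → R) → Set
  InCmA {n} {k} p x =
    (∀ j → 0# ≤ x j) ×
    (∀ (i : Fin k) (c : Fin k → ℕ) → Congr p c (p i) → x i ≤ dotℕ c x)

  InteriorCmA : ∀ {n k} → (Fin k → Fin (suc n)) → (Fin k → R) → Set
  InteriorCmA p x =
    Σ R (λ ε → (0# < ε) ×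
      (∀ z → (∀ j → (x j - ε < z j) × (z j < x j + ε)) → InCmA p z))

  IsMinVal : ∀ {n k} → (Fin k → Fin (suc n)) → (Fin k → R) →
             Fin (suc n) → R → Set
  IsMinVal p x i v =
    Σ _ (λ c → Congr p c i × dotℕ c x ≡ v) ×
    (∀ c → Congr p c i → v ≤ dotℕ c x)

  -- y = q(x) ∈ ℝ^{m-1}; coordinate j : Fin n stands for the residue suc j
  IsQ : ∀ {n k} → (Fin k → Fin (suc n)) → (Fin k → R) → (Fin n → R) → Set
  IsQ p x y = ∀ j → IsMinVal p x (suc j) (y j)

  ext : ∀ {n} → (Fin n → R) → Fin (suc n) → R
  ext z zero    = 0#
  ext z (suc j) = z j

  InKunz : ∀ {n} → (Fin n → R) → Set
  InKunz {n} z = ∀ (i j : Fin n) → (suc i ⊕ suc j) ≢ zero →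
                 ext z (suc i ⊕ suc j) ≤ z i + z j

  -- a linear functional a defines a face of C_m if a·z ≥ 0 on C_m;
  -- the face is then C_m ∩ {a·z = 0}
  IsSupporting : ∀ {n} → (Fin n → R) → Set
  IsSupporting a = ∀ z → InKunz z → 0# ≤ dot a z

  InFace : ∀ {n} → (Fin n → R) → (Fin n → R) → Set
  InFace a z = InKunz z × dot a z ≡ 0#

  -- relative interior of the (convex) face: y ∈ F and the segment from
  -- any z ∈ F through y extends beyond y inside F
  InRelint : ∀ {n} → (Fin n → R) → (Fin n → R) → Set
  InRelint a y =
    InFace a y ×
    (∀ z → InFace a z →
      Σ R (λ ε → (0# < ε) × InFace a (λ j → y j + ε * (y j - z j))))

  -- Kunz subgroup H = {0} ∪ {i : x_i = 0 for all x ∈ F} is trivial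
  TrivialKunzSubgroup : ∀ {n} → (Fin n → R) → Set
  TrivialKunzSubgroup {n} a =
    ∀ (i : Fin n) → ¬ (∀ x → InFace a x → x i ≡ 0#)

  -- Kunz nilsemigroup N = ℤ_m ∪ {∞}  (nothing = ∞)
  Nil : ℕ → Set
  Nil n = Maybe (Fin (suc n))

  -- graph of the operation of N:  NAdd a u v w  iff  u ⊕_N v = w
  data NAdd {n} (a : Fin n → R) : Nil n → Nil n → Nil n → Set where
    defined   : ∀ u v →
      (∀ x → InFace a x → ext x u + ext x v ≡ ext x (u ⊕ v)) →
      NAdd a (just u) (just v) (just (u ⊕ v))
    undefined : ∀ u v →
      ¬ (∀ x → InFace a x → ext x u + ext x v ≡ ext x (u ⊕ v)) →
      NAdd a (just u) (just v) nothing
    ∞ˡ : ∀ v → NAdd a nothing v nothing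
    ∞ʳ : ∀ u → NAdd a u nothing nothing

  IsAtom : ∀ {n} → (Fin n → R) → Nil n → Set
  IsAtom a w = w ≢ just zero ×
    ¬ (Σ _ (λ u → Σ _ (λ v → u ≢ just zero × v ≢ just zero × NAdd a u v w)))

{-# OPTIONS --safe #-}
-- Every residue has a cheapest representation
-- c · x (Bézout reaches it, and reducing coefficients modulo m lowers the cost), and adding two
-- of them shows that y is subadditive, i.e. lies in the Kunz cone. Summing the Kunz inequalities
-- that are tight at y gives a supporting functional whose face F has y in its relative interior,
-- since every inequality with slack at y keeps it a little beyond y. The coordinates of y are
-- positive, so the Kunz subgroup of F is trivial, and the sums defined in the nilsemigroup of F
-- are exactly the inequalities tight at y. A generator p_j is an atom: x_j can be raised alone
-- inside C(m;A), so x_j is cheaper than every other representation of p_j, whereas a tight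
-- decomposition p_j = u + v would give one of cost y_u + y_v = x_j. Conversely, removing one
-- p_j from a cheapest representation of an atom w writes w = p_j + v tightly at y, forcing v = 0.
module Submission where

open import Defs hiding (_<_; _-_; _·_)
import Defs
import Relation.Binary.Reasoning.PartialOrder as PartialOrderReasoning
import Data.List.Extrema as Extrema
open import Level using (0ℓ)
open import Algebra.Bundles using (CommutativeRing)
open import Data.Nat as ℕ using (ℕ; zero; suc; z≤n; s≤s; _∸_; _%_)
import Data.Nat.Properties as ℕₚ
open import Data.Nat.DivMod
  using (_mod_; m%n<n; m%n≤m; m<n⇒m%n≡m; %-distribˡ-+; %-distribˡ-*; m%n%n≡m%n; n%n≡0; [m+kn]%n≡m%n)
open import Data.Nat.Tactic.RingSolver using (solve-∀)
open import Data.Nat.GCD using (gcd; gcd-GCD; module Bézout)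
open import Data.Integer as ℤ using (ℤ; -[1+_]; _⊖_)
import Data.Integer.Properties as ℤₚ
open import Data.Sign as Sign using (Sign)
open import Data.Fin as Fin using (Fin; zero; suc; toℕ)
import Data.Fin.Properties as Finₚ
open import Data.Vec.Functional as Vector using (zipWith; updateAt)
open import Data.Vec.Functional.Properties using (updateAt-updates; updateAt-minimal)
open import Data.List using (List; []; _∷_; upTo; cartesianProductWith; filter)
open import Data.List.Membership.Propositional using (_∈_)
open import Data.List.Membership.Propositional.Properties
  using (∈-cartesianProductWith⁺; ∈-upTo⁺; ∈-filter⁺)
open import Data.List.Relation.Unary.All as All using (All)
open import Data.List.Relation.Unary.All.Properties using (all-filter)
open import Data.List.Relation.Unary.Any using (here)
open import Data.Maybe using (Maybe; just; nothing)
import Data.Maybe.Properties as Maybe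
open import Data.Product using (Σ; ∃; _×_; _,_; proj₁; proj₂)
open import Data.Sum using (_⊎_; inj₁; inj₂)
open import Data.Empty using (⊥; ⊥-elim)
open import Function using (_∘_; _⇔_; mk⇔)
open import Function.Definitions using (Injective)
open import Relation.Nullary using (¬_; Dec; yes; no; contradiction)
open import Relation.Nullary.Decidable using (_×-dec_; ¬?)
open import Relation.Binary.Bundles using (TotalOrder)
open import Relation.Binary.Definitions using (DecidableEquality)
open import Relation.Binary.PropositionalEquality as ≡
  using (_≡_; _≢_; _≗_; refl; sym; trans; cong; cong₂; subst; subst₂; module ≡-Reasoning)

-- The ring solver normalises coefficients by computation, which the abstract carrier of a RealField
-- cannot do; integer coefficients, mapped into any commutative ring, can.
module IntegerCoefficients {c ℓ} (R : CommutativeRing c ℓ) where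
  open CommutativeRing R renaming (refl to ≈-refl; sym to ≈-sym; trans to ≈-trans)
  open import Algebra.Properties.Ring ring
    using (-‿involutive; -0#≈0#; -‿distribˡ-*; -‿distribʳ-*)
  open import Algebra.Properties.AbelianGroup +-abelianGroup using (⁻¹-∙-comm)
  open import Algebra.Properties.Semiring.Mult semiring using (×-homo-+; ×1-homo-*) renaming (_×_ to _·_)
  open import Algebra.Solver.Ring.AlmostCommutativeRing
  open import Relation.Binary.Reasoning.Setoid setoid

  signed : Sign → Carrier → Carrier
  signed Sign.+ x = x
  signed Sign.- x = - x

  ⟦_⟧ : ℤ → Carrier
  ⟦ i ⟧ = signed (ℤ.sign i) (ℤ.∣ i ∣ · 1#)

  ⟦◃⟧ : ∀ s n → ⟦ s ℤ.◃ n ⟧ ≈ signed s (n · 1#)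
  ⟦◃⟧ Sign.+ zero    = ≈-refl
  ⟦◃⟧ Sign.- zero    = ≈-sym -0#≈0#
  ⟦◃⟧ Sign.+ (suc n) = ≈-refl
  ⟦◃⟧ Sign.- (suc n) = ≈-refl

  signed-* : ∀ s t x y → signed (s Sign.* t) (x * y) ≈ signed s x * signed t y
  signed-* Sign.+ Sign.+ x y = ≈-refl
  signed-* Sign.+ Sign.- x y = -‿distribʳ-* x y
  signed-* Sign.- Sign.+ x y = -‿distribˡ-* x y
  signed-* Sign.- Sign.- x y = begin
    x * y        ≈⟨ *-congʳ (≈-sym (-‿involutive x)) ⟩
    - (- x) * y  ≈⟨ ≈-sym (-‿distribˡ-* (- x) y) ⟩
    - (- x * y)  ≈⟨ -‿distribʳ-* (- x) y ⟩
    - x * - y    ∎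

  signed-cong : ∀ s {x y} → x ≈ y → signed s x ≈ signed s y
  signed-cong Sign.+ x≈y = x≈y
  signed-cong Sign.- x≈y = -‿cong x≈y

  ⟦⟧-*-homo : ∀ i j → ⟦ i ℤ.* j ⟧ ≈ ⟦ i ⟧ * ⟦ j ⟧
  ⟦⟧-*-homo i j = begin
    ⟦ s Sign.* t ℤ.◃ a ℕ.* b ⟧                 ≈⟨ ⟦◃⟧ (s Sign.* t) (a ℕ.* b) ⟩
    signed (s Sign.* t) ((a ℕ.* b) · 1#)       ≈⟨ signed-cong (s Sign.* t) (×1-homo-* a b) ⟩
    signed (s Sign.* t) ((a · 1#) * (b · 1#))  ≈⟨ signed-* s t _ _ ⟩
    signed s (a · 1#) * signed t (b · 1#)      ∎
    where s = ℤ.sign i; t = ℤ.sign j; a = ℤ.∣ i ∣; b = ℤ.∣ j ∣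

  a-b≈[1+a]-[1+b] : ∀ a b → a - b ≈ (1# + a) - (1# + b)
  a-b≈[1+a]-[1+b] a b = ≈-sym (begin
    (1# + a) - (1# + b)      ≈⟨ +-congˡ (≈-sym (⁻¹-∙-comm 1# b)) ⟩
    (1# + a) + (- 1# + - b)  ≈⟨ +-congʳ (+-comm 1# a) ⟩
    (a + 1#) + (- 1# + - b)  ≈⟨ +-assoc a 1# _ ⟩
    a + (1# + (- 1# + - b))  ≈⟨ +-congˡ (≈-sym (+-assoc 1# (- 1#) (- b))) ⟩
    a + ((1# - 1#) + - b)    ≈⟨ +-congˡ (+-congʳ (-‿inverseʳ 1#)) ⟩
    a + (0# + - b)           ≈⟨ +-congˡ (+-identityˡ (- b)) ⟩
    a - b                    ∎)

  ⟦⊖⟧ : ∀ m n → ⟦ m ⊖ n ⟧ ≈ m · 1# - n · 1#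
  ⟦⊖⟧ zero    zero    = ≈-sym (-‿inverseʳ 0#)
  ⟦⊖⟧ zero    (suc n) = ≈-sym (+-identityˡ _)
  ⟦⊖⟧ (suc m) zero    = ≈-sym (≈-trans (+-congˡ -0#≈0#) (+-identityʳ _))
  ⟦⊖⟧ (suc m) (suc n) = begin
    ⟦ suc m ⊖ suc n ⟧        ≡⟨ ≡.cong ⟦_⟧ (ℤₚ.[1+m]⊖[1+n]≡m⊖n m n) ⟩
    ⟦ m ⊖ n ⟧                ≈⟨ ⟦⊖⟧ m n ⟩
    m · 1# - n · 1#          ≈⟨ a-b≈[1+a]-[1+b] _ _ ⟩
    suc m · 1# - suc n · 1#  ∎

  ⟦⟧-+-homo : ∀ i j → ⟦ i ℤ.+ j ⟧ ≈ ⟦ i ⟧ + ⟦ j ⟧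
  ⟦⟧-+-homo (ℤ.+ m)  (ℤ.+ n)  = ×-homo-+ 1# m n
  ⟦⟧-+-homo (ℤ.+ m)  -[1+ n ] = ⟦⊖⟧ m (suc n)
  ⟦⟧-+-homo -[1+ m ] (ℤ.+ n)  = ≈-trans (⟦⊖⟧ n (suc m)) (+-comm _ _)
  ⟦⟧-+-homo -[1+ m ] -[1+ n ] = begin
    - (suc (suc (m ℕ.+ n)) · 1#)       ≡⟨ ≡.cong (λ k → - (suc k · 1#)) (ℕₚ.+-suc m n) ⟨
    - ((suc m ℕ.+ suc n) · 1#)         ≈⟨ -‿cong (×-homo-+ 1# (suc m) (suc n)) ⟩
    - (suc m · 1# + suc n · 1#)        ≈⟨ ⁻¹-∙-comm _ _ ⟨
    - (suc m · 1#) + - (suc n · 1#)    ∎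

  ⟦⟧-‿homo : ∀ i → ⟦ ℤ.- i ⟧ ≈ - ⟦ i ⟧
  ⟦⟧-‿homo -[1+ n ]      = ≈-sym (-‿involutive _)
  ⟦⟧-‿homo (ℤ.+ zero)    = ≈-sym -0#≈0#
  ⟦⟧-‿homo (ℤ.+ (suc n)) = ≈-refl

  homomorphism : CommutativeRing.rawRing ℤₚ.+-*-commutativeRing
                   -Raw-AlmostCommutative⟶ fromCommutativeRing R
  homomorphism = record
    { ⟦_⟧    = ⟦_⟧
    ; +-homo = ⟦⟧-+-homo
    ; *-homo = ⟦⟧-*-homo
    ; -‿homo = ⟦⟧-‿homo
    ; 0-homo = ≈-refl
    ; 1-homo = +-identityʳ 1#
    }

  ⟦⟧-≟ : ∀ i j → Maybe (⟦ i ⟧ ≈ ⟦ j ⟧)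
  ⟦⟧-≟ i j with i ℤₚ.≟ j
  ... | yes i≡j = just (reflexive (≡.cong ⟦_⟧ i≡j))
  ... | no _    = nothing

  open import Algebra.Solver.Ring (CommutativeRing.rawRing ℤₚ.+-*-commutativeRing)
    (fromCommutativeRing R) homomorphism ⟦⟧-≟ public
    using (solve; _:=_; _:+_; _:*_; :-_; _:-_)

module RealFieldProperties (ℝ : RealField) where
  open RealField ℝ public

  commutativeRing : CommutativeRing 0ℓ 0ℓ
  commutativeRing = record { isCommutativeRing = isCommutativeRing }

  totalOrder : TotalOrder 0ℓ 0ℓ 0ℓ
  totalOrder = record { isTotalOrder = isTotalOrder }

  open CommutativeRing commutativeRing public
    using (_-_; +-assoc; +-comm; +-identityˡ; +-identityʳ; -‿inverseʳ; *-identityˡ; *-identityʳ;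
           zeroˡ; zeroʳ; distribˡ; distribʳ; ring; +-group; +-commutativeSemigroup)
  open import Algebra.Properties.CommutativeSemigroup +-commutativeSemigroup using (interchange)
  open import Algebra.Properties.Ring ring public using (-‿involutive; -0#≈0#; -‿distribʳ-*; -1*x≈-x)
  open import Algebra.Properties.Group +-group public using (∙-cancelˡ; ⁻¹-injective; x∙y⁻¹≈ε⇒x≈y)
  open TotalOrder totalOrder public
    using (total; antisym; reflexive; poset) renaming (refl to ≤-refl; trans to ≤-trans)
  open import Relation.Binary.Properties.TotalOrder totalOrder public
    using (_<_; <-irrefl; <-trans; <⇒≱)
  open IntegerCoefficients commutativeRing public using (solve; _:=_; _:+_; _:*_; :-_; _:-_)
  module ≤-Reasoning = PartialOrderReasoning poset

  infixr 8 _·_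
  _·_ : ℕ → R → R
  _·_ = Defs._·_ ℝ

  +-monoˡ-≤ : ∀ z {x y} → x ≤ y → x + z ≤ y + z
  +-monoˡ-≤ z = +-mono z

  +-monoʳ-≤ : ∀ z {x y} → x ≤ y → z + x ≤ z + y
  +-monoʳ-≤ z {x} {y} x≤y = subst₂ _≤_ (+-comm x z) (+-comm y z) (+-mono z x≤y)

  +-mono-≤ : ∀ {a b c d} → a ≤ b → c ≤ d → a + c ≤ b + d
  +-mono-≤ {b = b} {c} a≤b c≤d = ≤-trans (+-monoˡ-≤ c a≤b) (+-monoʳ-≤ b c≤d)

  +-cancelˡ-≤ : ∀ z {x y} → z + x ≤ z + y → x ≤ y
  +-cancelˡ-≤ z {x} {y} h = subst₂ _≤_ (cancel x) (cancel y) (+-monoʳ-≤ (- z) h)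
    where
    cancel : ∀ w → - z + (z + w) ≡ w
    cancel w = solve 2 (λ z w → :- z :+ (z :+ w) := w) refl z w

  +-monoʳ-< : ∀ z {x y} → x < y → z + x < z + y
  +-monoʳ-< z {x} {y} (x≤y , x≢y) = +-monoʳ-≤ z x≤y , λ eq → x≢y (∙-cancelˡ z x y eq)

  x≤y⇒0≤y-x : ∀ {x y} → x ≤ y → 0# ≤ y - x
  x≤y⇒0≤y-x {x} {y} h = subst (_≤ y - x) (-‿inverseʳ x) (+-monoˡ-≤ (- x) h)

  0≤y-x⇒x≤y : ∀ {x y} → 0# ≤ y - x → x ≤ y
  0≤y-x⇒x≤y {x} {y} h =
    subst₂ _≤_ (+-identityˡ x) (solve 2 (λ x y → (y :- x) :+ x := y) refl x y) (+-monoˡ-≤ x h)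

  neg-antimono-≤ : ∀ {x y} → x ≤ y → - y ≤ - x
  neg-antimono-≤ {x} {y} h = 0≤y-x⇒x≤y
    (subst (0# ≤_) (solve 2 (λ x y → y :- x := :- x :- :- y) refl x y) (x≤y⇒0≤y-x h))

  neg-antimono-< : ∀ {x y} → x < y → - y < - x
  neg-antimono-< (x≤y , x≢y) = neg-antimono-≤ x≤y , λ eq → x≢y (⁻¹-injective (sym eq))

  pos⇒-neg : ∀ {x} → 0# < x → - x < 0#
  pos⇒-neg 0<x = subst (_ <_) -0#≈0# (neg-antimono-< 0<x)

  0≤1 : 0# ≤ 1#
  0≤1 with total 0# 1#
  ... | inj₁ 0≤1 = 0≤1
  ... | inj₂ 1≤0 = ⊥-elim (0≢1 (antisym 0≤[-1]*[-1] 1≤0))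
    where
    0≤-1 : 0# ≤ - 1#
    0≤-1 = subst (_≤ - 1#) -0#≈0# (neg-antimono-≤ 1≤0)
    0≤[-1]*[-1] : 0# ≤ 1#
    0≤[-1]*[-1] = subst (0# ≤_) (trans (-1*x≈-x (- 1#)) (-‿involutive 1#)) (*-nonneg 0≤-1 0≤-1)

  0<1 : 0# < 1#
  0<1 = 0≤1 , 0≢1

  +-nonneg : ∀ {x y} → 0# ≤ x → 0# ≤ y → 0# ≤ x + y
  +-nonneg {x} {y} 0≤x 0≤y = subst (_≤ x + y) (+-identityʳ 0#) (+-mono-≤ 0≤x 0≤y)

  x≤x+y : ∀ x {y} → 0# ≤ y → x ≤ x + y
  x≤x+y x {y} 0≤y = subst (_≤ x + y) (+-identityʳ x) (+-monoʳ-≤ x 0≤y)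

  x<x+y : ∀ x {y} → 0# < y → x < x + y
  x<x+y x {y} 0<y = subst (_< x + y) (+-identityʳ x) (+-monoʳ-< x 0<y)

  pos+nonneg : ∀ {x y} → 0# < x → 0# ≤ y → 0# < x + y
  pos+nonneg {x} {y} 0<x 0≤y = begin-strict
    0#     <⟨ 0<x ⟩
    x      ≤⟨ x≤x+y x 0≤y ⟩
    x + y  ∎
    where open ≤-Reasoning

  x≤x+y⇒0≤y : ∀ x {y} → x ≤ x + y → 0# ≤ y
  x≤x+y⇒0≤y x {y} h = +-cancelˡ-≤ x (subst (_≤ x + y) (sym (+-identityʳ x)) h)

  nonneg-+-zeroˡ : ∀ {x y} → 0# ≤ x → 0# ≤ y → x + y ≡ 0# → x ≡ 0#
  nonneg-+-zeroˡ {x} 0≤x 0≤y x+y≡0 = antisym (subst (x ≤_) x+y≡0 (x≤x+y x 0≤y)) 0≤x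

  *-monoʳ-≤-nonneg : ∀ {x y} z → 0# ≤ z → x ≤ y → x * z ≤ y * z
  *-monoʳ-≤-nonneg {x} {y} z 0≤z x≤y = 0≤y-x⇒x≤y (subst (0# ≤_)
    (solve 3 (λ x y z → (y :- x) :* z := y :* z :- x :* z) refl x y z)
    (*-nonneg (x≤y⇒0≤y-x x≤y) 0≤z))

  *-pos : ∀ {x y} → 0# < x → 0# < y → 0# < x * y
  *-pos {x} {y} (0≤x , 0≢x) (0≤y , 0≢y) = *-nonneg 0≤x 0≤y , 0≢x*y
    where
    0≢x*y : 0# ≢ x * y
    0≢x*y 0≡xy with inverse x (0≢x ∘ sym)
    ... | x⁻¹ , xx⁻¹≡1 = 0≢y (begin
      0#              ≡⟨ sym (zeroʳ x⁻¹) ⟩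
      x⁻¹ * 0#        ≡⟨ cong (x⁻¹ *_) 0≡xy ⟩
      x⁻¹ * (x * y)   ≡⟨ solve 3 (λ x x⁻¹ y → x⁻¹ :* (x :* y) := (x :* x⁻¹) :* y) refl x x⁻¹ y ⟩
      (x * x⁻¹) * y   ≡⟨ cong (_* y) xx⁻¹≡1 ⟩
      1# * y          ≡⟨ *-identityˡ y ⟩
      y               ∎)
      where open ≡-Reasoning

  inverse-pos : ∀ {x y} → 0# < x → x * y ≡ 1# → 0# < y
  inverse-pos {x} {y} (0≤x , _) xy≡1 with total 0# y
  ... | inj₁ 0≤y = 0≤y , λ 0≡y → 0≢1 (trans (sym (zeroʳ x)) (trans (cong (x *_) 0≡y) xy≡1))
  ... | inj₂ y≤0 = ⊥-elim (<⇒≱ 0<1 1≤0)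
    where
    0≤-1 : 0# ≤ - 1#
    0≤-1 = subst (0# ≤_) (trans (sym (-‿distribʳ-* x y)) (cong -_ xy≡1))
                 (*-nonneg 0≤x (subst (_≤ - y) -0#≈0# (neg-antimono-≤ y≤0)))
    1≤0 : 1# ≤ 0#
    1≤0 = subst₂ _≤_ (-‿involutive 1#) -0#≈0# (neg-antimono-≤ 0≤-1)

  positive-below : ∀ {ε} → 0# < ε → ∃ λ δ → 0# < δ × δ < ε
  positive-below {ε} 0<ε = ε * ½ , 0<δ , subst (ε * ½ <_) δ+δ≡ε (x<x+y (ε * ½) 0<δ)
    where
    0<2 : 0# < 1# + 1#
    0<2 = <-trans 0<1 (x<x+y 1# 0<1)
    halving = inverse (1# + 1#) (λ 2≡0 → proj₂ 0<2 (sym 2≡0))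
    ½ = proj₁ halving
    0<δ : 0# < ε * ½
    0<δ = *-pos 0<ε (inverse-pos 0<2 (proj₂ halving))
    δ+δ≡ε : ε * ½ + ε * ½ ≡ ε
    δ+δ≡ε = begin
      ε * ½ + ε * ½              ≡⟨ distribˡ ε ½ ½ ⟨
      ε * (½ + ½)                ≡⟨ cong (ε *_) (cong₂ _+_ (*-identityˡ ½) (*-identityˡ ½)) ⟨
      ε * (1# * ½ + 1# * ½)      ≡⟨ cong (ε *_) (distribʳ ½ 1# 1#) ⟨
      ε * ((1# + 1#) * ½)        ≡⟨ cong (ε *_) (proj₂ halving) ⟩
      ε * 1#                     ≡⟨ *-identityʳ ε ⟩
      ε                          ∎
      where open ≡-Reasoning

  ·-zeroʳ : ∀ k → k · 0# ≡ 0#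
  ·-zeroʳ zero    = refl
  ·-zeroʳ (suc k) = trans (+-identityˡ (k · 0#)) (·-zeroʳ k)

  ·-identityˡ : ∀ r → 1 · r ≡ r
  ·-identityˡ = +-identityʳ

  ·-distribʳ-+ : ∀ a b r → (a ℕ.+ b) · r ≡ a · r + b · r
  ·-distribʳ-+ zero    b r = sym (+-identityˡ (b · r))
  ·-distribʳ-+ (suc a) b r = trans (cong (r +_) (·-distribʳ-+ a b r)) (sym (+-assoc r (a · r) (b · r)))

  ·-nonneg : ∀ k {r} → 0# ≤ r → 0# ≤ k · r
  ·-nonneg zero    0≤r = ≤-refl
  ·-nonneg (suc k) 0≤r = +-nonneg 0≤r (·-nonneg k 0≤r)

  ·-monoˡ-≤ : ∀ {a b r} → a ℕ.≤ b → 0# ≤ r → a · r ≤ b · r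
  ·-monoˡ-≤ {b = b} z≤n     0≤r = ·-nonneg b 0≤r
  ·-monoˡ-≤ {r = r} (s≤s a≤b) 0≤r = +-monoʳ-≤ r (·-monoˡ-≤ a≤b 0≤r)

  archimedean : ∀ {t} → 0# ≤ t → (∀ k → k · t ≤ 1#) → t ≡ 0#
  archimedean {t} 0≤t bounded = antisym t≤0 0≤t
    where
    Multiple : R → Set
    Multiple r = ∃ λ k → r ≡ k · t
    lub = sup Multiple (0# , 0 , refl) (1# , λ { r (k , refl) → bounded k })
    s = proj₁ lub
    s≤s-t : s ≤ s - t
    s≤s-t = proj₂ (proj₂ lub) (s - t) λ { r (k , refl) → subst (_≤ s - t)
      (solve 2 (λ t r → (t :+ r) :- t := r) refl t (k · t))
      (+-monoˡ-≤ (- t) (proj₁ (proj₂ lub) (suc k · t) (suc k , refl))) }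
    t≤0 : t ≤ 0#
    t≤0 = subst₂ _≤_ (-‿involutive t) -0#≈0# (neg-antimono-≤ (x≤x+y⇒0≤y s s≤s-t))

  -- The supremum axiom yields weak excluded middle (compare the truth values of A and ¬ A) and,
  -- through the Archimedean property, ¬¬-stable equality: equality of reals is decidable.
  truth-value : (A : Set) → ∃ λ s → (A → 1# ≤ s) × (¬ A → s ≤ 0#)
  truth-value A = proj₁ lub , (λ a → proj₁ (proj₂ lub) 1# (inj₂ (refl , a))) ,
                  λ ¬a → proj₂ (proj₂ lub) 0#
                           λ { r (inj₁ refl) → ≤-refl ; r (inj₂ (_ , a)) → ⊥-elim (¬a a) }
    where
    Witness : R → Set
    Witness r = r ≡ 0# ⊎ (r ≡ 1# × A)
    lub = sup Witness (0# , inj₁ refl)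
                      (1# , λ { r (inj₁ refl) → 0≤1 ; r (inj₂ (refl , _)) → ≤-refl })

  ¬-or-¬¬ : (A : Set) → ¬ A ⊎ ¬ ¬ A
  ¬-or-¬¬ A with truth-value A | truth-value (¬ A)
  ... | s , A⇒1≤s , ¬A⇒s≤0 | s′ , ¬A⇒1≤s′ , ¬¬A⇒s′≤0 with total s s′
  ...   | inj₁ s≤s′ = inj₁ λ a → <⇒≱ 0<1 (≤-trans (A⇒1≤s a) (≤-trans s≤s′ (¬¬A⇒s′≤0 (λ ¬a → ¬a a))))
  ...   | inj₂ s′≤s = inj₂ λ ¬a → <⇒≱ 0<1 (≤-trans (¬A⇒1≤s′ ¬a) (≤-trans s′≤s (¬A⇒s≤0 ¬a)))

  nonneg-stable : ∀ {t} → 0# ≤ t → ¬ ¬ (t ≡ 0#) → t ≡ 0#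
  nonneg-stable {t} 0≤t ¬¬t≡0 = archimedean 0≤t multiple≤1
    where
    multiple≤1 : ∀ k → k · t ≤ 1#
    multiple≤1 k with total (k · t) 1#
    ... | inj₁ kt≤1 = kt≤1
    ... | inj₂ 1≤kt = ⊥-elim (¬¬t≡0 λ t≡0 →
                        <⇒≱ 0<1 (subst (1# ≤_) (trans (cong (k ·_) t≡0) (·-zeroʳ k)) 1≤kt))

  ≡-stable-≤ : ∀ {x y} → x ≤ y → ¬ ¬ (y ≡ x) → y ≡ x
  ≡-stable-≤ {x} {y} x≤y ¬¬y≡x = x∙y⁻¹≈ε⇒x≈y y x (nonneg-stable (x≤y⇒0≤y-x x≤y)
    λ y-x≢0 → ¬¬y≡x λ y≡x → y-x≢0 (trans (cong (_- x) y≡x) (-‿inverseʳ x)))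

  ≡-stable : ∀ {x y} → ¬ ¬ (x ≡ y) → x ≡ y
  ≡-stable {x} {y} ¬¬x≡y with total x y
  ... | inj₁ x≤y = sym (≡-stable-≤ x≤y (λ y≢x → ¬¬x≡y (y≢x ∘ sym)))
  ... | inj₂ y≤x = ≡-stable-≤ y≤x ¬¬x≡y

  infix 4 _≟_
  _≟_ : DecidableEquality R
  x ≟ y with ¬-or-¬¬ (x ≡ y)
  ... | inj₁ x≢y   = no x≢y
  ... | inj₂ ¬¬x≡y = yes (≡-stable ¬¬x≡y)

  finite-lower-bound : ∀ {N} (ε : Fin N → R) → (∀ i → 0# < ε i) →
                       ∃ λ δ → 0# < δ × (∀ i → δ ≤ ε i)
  finite-lower-bound {zero}  ε pos = 1# , 0<1 , λ ()
  finite-lower-bound {suc N} ε pos with finite-lower-bound (ε ∘ suc) (pos ∘ suc)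
  ... | δ , 0<δ , δ≤ε∘suc with total (ε zero) δ
  ...   | inj₁ ε₀≤δ = ε zero , pos zero , λ { zero → ≤-refl ; (suc i) → ≤-trans ε₀≤δ (δ≤ε∘suc i) }
  ...   | inj₂ δ≤ε₀ = δ , 0<δ , λ { zero → δ≤ε₀ ; (suc i) → δ≤ε∘suc i }

  finite-lower-bound₂ : ∀ {M N} (ε : Fin M → Fin N → R) → (∀ i j → 0# < ε i j) →
                        ∃ λ δ → 0# < δ × (∀ i j → δ ≤ ε i j)
  finite-lower-bound₂ ε pos = proj₁ bound , proj₁ (proj₂ bound) ,
                              λ i j → ≤-trans (proj₂ (proj₂ bound) i) (proj₂ (proj₂ (row i)) j)
    where
    row : ∀ i → ∃ λ δ → 0# < δ × (∀ j → δ ≤ ε i j)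
    row i = finite-lower-bound (ε i) (pos i)
    bound = finite-lower-bound (proj₁ ∘ row) (proj₁ ∘ proj₂ ∘ row)

  sumR-cong : ∀ {k} {f g : Fin k → R} → f ≗ g → sumR ℝ f ≡ sumR ℝ g
  sumR-cong {zero}  f≗g = refl
  sumR-cong {suc k} f≗g = cong₂ _+_ (f≗g zero) (sumR-cong (f≗g ∘ suc))

  sumR-zero : ∀ k → sumR ℝ {k} (λ _ → 0#) ≡ 0#
  sumR-zero zero    = refl
  sumR-zero (suc k) = trans (+-identityˡ _) (sumR-zero k)

  sumR-vanishing : ∀ {k} {f : Fin k → R} → (∀ j → f j ≡ 0#) → sumR ℝ f ≡ 0#
  sumR-vanishing {k} f≗0 = trans (sumR-cong f≗0) (sumR-zero k)

  sumR-+ : ∀ {k} (f g : Fin k → R) → sumR ℝ (λ j → f j + g j) ≡ sumR ℝ f + sumR ℝ g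
  sumR-+ {zero}  f g = sym (+-identityˡ 0#)
  sumR-+ {suc k} f g = trans (cong (f zero + g zero +_) (sumR-+ (f ∘ suc) (g ∘ suc)))
    (interchange (f zero) (g zero) _ _)

  sumR-neg : ∀ {k} (f : Fin k → R) → sumR ℝ (λ j → - f j) ≡ - sumR ℝ f
  sumR-neg {zero}  f = sym -0#≈0#
  sumR-neg {suc k} f = trans (cong (- f zero +_) (sumR-neg (f ∘ suc)))
    (solve 2 (λ a b → :- a :+ :- b := :- (a :+ b)) refl (f zero) _)

  sumR-*ʳ : ∀ {k} (f : Fin k → R) c → sumR ℝ f * c ≡ sumR ℝ (λ j → f j * c)
  sumR-*ʳ {zero}  f c = zeroˡ c
  sumR-*ʳ {suc k} f c = trans (distribʳ c (f zero) _) (cong (f zero * c +_) (sumR-*ʳ (f ∘ suc) c))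

  sumR-comm : ∀ {k l} (f : Fin k → Fin l → R) →
              sumR ℝ (λ i → sumR ℝ (λ j → f i j)) ≡ sumR ℝ (λ j → sumR ℝ (λ i → f i j))
  sumR-comm {zero}  {l} f = sym (sumR-zero l)
  sumR-comm {suc k} f = trans (cong (sumR ℝ (f zero) +_) (sumR-comm (f ∘ suc)))
    (sym (sumR-+ (f zero) (λ j → sumR ℝ (λ i → f (suc i) j))))

  sumR-mono-≤ : ∀ {k} {f g : Fin k → R} → (∀ j → f j ≤ g j) → sumR ℝ f ≤ sumR ℝ g
  sumR-mono-≤ {zero}  f≤g = ≤-refl
  sumR-mono-≤ {suc k} f≤g = +-mono-≤ (f≤g zero) (sumR-mono-≤ (f≤g ∘ suc))

  sumR-nonneg : ∀ {k} {f : Fin k → R} → (∀ j → 0# ≤ f j) → 0# ≤ sumR ℝ f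
  sumR-nonneg {k} {f} 0≤f = subst (_≤ sumR ℝ f) (sumR-zero k) (sumR-mono-≤ 0≤f)

  sumR-nonneg-zero : ∀ {k} {f : Fin k → R} → (∀ j → 0# ≤ f j) → sumR ℝ f ≡ 0# → ∀ j → f j ≡ 0#
  sumR-nonneg-zero {suc k} 0≤f Σf≡0 zero = nonneg-+-zeroˡ (0≤f zero) (sumR-nonneg (0≤f ∘ suc)) Σf≡0
  sumR-nonneg-zero {suc k} {f} 0≤f Σf≡0 (suc j) = sumR-nonneg-zero (0≤f ∘ suc)
    (nonneg-+-zeroˡ (sumR-nonneg (0≤f ∘ suc)) (0≤f zero) (trans (+-comm _ (f zero)) Σf≡0)) j

  kronecker : ∀ {k} → Fin k → Fin k → R
  kronecker zero    zero    = 1#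
  kronecker zero    (suc _) = 0#
  kronecker (suc _) zero    = 0#
  kronecker (suc i) (suc j) = kronecker i j

  sumR-kronecker : ∀ {k} (i : Fin k) (z : Fin k → R) → sumR ℝ (λ j → kronecker i j * z j) ≡ z i
  sumR-kronecker {suc k} zero z = begin
    1# * z zero + sumR ℝ (λ j → 0# * z (suc j))
      ≡⟨ cong₂ _+_ (*-identityˡ (z zero)) (sumR-cong (λ j → zeroˡ (z (suc j)))) ⟩
    z zero + sumR ℝ {k} (λ _ → 0#)               ≡⟨ cong (z zero +_) (sumR-zero k) ⟩
    z zero + 0#                                  ≡⟨ +-identityʳ (z zero) ⟩
    z zero                                       ∎
    where open ≡-Reasoning
  sumR-kronecker (suc i) z =
    trans (cong (_+ sumR ℝ (λ j → kronecker i j * z (suc j))) (zeroˡ (z zero)))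
          (trans (+-identityˡ _) (sumR-kronecker i (z ∘ suc)))

  x+δ[x-x]≡x : ∀ x δ → x + δ * (x - x) ≡ x
  x+δ[x-x]≡x = solve 2 (λ x δ → x :+ δ :* (x :- x) := x) refl

  -- s + δ (s - t) is the value at y + δ (y - z) of an affine map equal to s at y and to t at z.
  affine-step : ∀ {s t} → 0# ≤ s → 0# ≤ t → (s ≡ 0# → t ≡ 0#) →
                ∃ λ ε → 0# < ε × (∀ δ → 0# ≤ δ → δ ≤ ε → 0# ≤ s + δ * (s - t))
  affine-step {s} {t} 0≤s 0≤t s≡0⇒t≡0 with s ≟ 0#
  ... | yes s≡0 = 1# , 0<1 , λ δ _ _ → reflexive (sym (begin
    s + δ * (s - t)  ≡⟨ cong (λ t → s + δ * (s - t)) (trans (s≡0⇒t≡0 s≡0) (sym s≡0)) ⟩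
    s + δ * (s - s)  ≡⟨ x+δ[x-x]≡x s δ ⟩
    s                ≡⟨ s≡0 ⟩
    0#               ∎))
    where open ≡-Reasoning
  ... | no s≢0 = s * r , *-pos (0≤s , s≢0 ∘ sym) 0<r , nonneg
    where
    0<1+t : 0# < 1# + t
    0<1+t = pos+nonneg 0<1 0≤t
    reciprocal = inverse (1# + t) (λ 1+t≡0 → proj₂ 0<1+t (sym 1+t≡0))
    r = proj₁ reciprocal
    0<r : 0# < r
    0<r = inverse-pos 0<1+t (proj₂ reciprocal)
    nonneg : ∀ δ → 0# ≤ δ → δ ≤ s * r → 0# ≤ s + δ * (s - t)
    nonneg δ 0≤δ δ≤sr = subst (0# ≤_)
      (solve 3 (λ s t δ → (s :- δ :* t) :+ δ :* s := s :+ δ :* (s :- t)) refl s t δ)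
      (+-nonneg (x≤y⇒0≤y-x δt≤s) (*-nonneg 0≤δ 0≤s))
      where
      δt≤s : δ * t ≤ s
      δt≤s = begin
        δ * t                     ≤⟨ *-monoʳ-≤-nonneg t 0≤t δ≤sr ⟩
        s * r * t                 ≤⟨ x≤x+y (s * r * t) (*-nonneg 0≤s (proj₁ 0<r)) ⟩
        s * r * t + s * r         ≡⟨ cong (λ u → s * r * t + s * u) (sym (*-identityˡ r)) ⟩
        s * r * t + s * (1# * r)
          ≡⟨ solve 4 (λ s r t o → s :* r :* t :+ s :* (o :* r) := s :* ((o :+ t) :* r)) refl s r t 1# ⟩
        s * ((1# + t) * r)        ≡⟨ cong (s *_) (proj₂ reciprocal) ⟩
        s * 1#                    ≡⟨ *-identityʳ s ⟩
        s                         ∎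
        where open ≤-Reasoning

open import Algebra.Properties.CommutativeSemigroup ℕₚ.+-commutativeSemigroup
  using () renaming (interchange to ℕ-interchange)

sumℕ-cong : ∀ {k} {f g : Fin k → ℕ} → f ≗ g → sumℕ f ≡ sumℕ g
sumℕ-cong {zero}  f≗g = refl
sumℕ-cong {suc k} f≗g = cong₂ ℕ._+_ (f≗g zero) (sumℕ-cong (f≗g ∘ suc))

sumℕ-zero : ∀ k → sumℕ {k} (λ _ → 0) ≡ 0
sumℕ-zero zero    = refl
sumℕ-zero (suc k) = sumℕ-zero k

sumℕ-+ : ∀ {k} (f g : Fin k → ℕ) → sumℕ (λ j → f j ℕ.+ g j) ≡ sumℕ f ℕ.+ sumℕ g
sumℕ-+ {zero}  f g = refl
sumℕ-+ {suc k} f g = trans (cong (f zero ℕ.+ g zero ℕ.+_) (sumℕ-+ (f ∘ suc) (g ∘ suc)))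
                           (ℕ-interchange (f zero) (g zero) _ _)

unit : ∀ {k} → Fin k → Fin k → ℕ
unit zero    zero    = 1
unit zero    (suc _) = 0
unit (suc _) zero    = 0
unit (suc i) (suc j) = unit i j

unit-≤ : ∀ {k} {c : Fin k → ℕ} i → c i ≢ 0 → ∀ j → unit i j ℕ.≤ c j
unit-≤ {c = c} zero    ci≢0 zero    = ℕₚ.n≢0⇒n>0 ci≢0
unit-≤         zero    ci≢0 (suc j) = z≤n
unit-≤         (suc i) ci≢0 zero    = z≤n
unit-≤ {c = c} (suc i) ci≢0 (suc j) = unit-≤ {c = c ∘ suc} i ci≢0 j

decrement : ∀ {k} → (Fin k → ℕ) → Fin k → Fin k → ℕ
decrement c i j = c j ∸ unit i j

unit-split : ∀ {k} {c : Fin k → ℕ} i → c i ≢ 0 → c ≗ zipWith ℕ._+_ (unit i) (decrement c i)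
unit-split i ci≢0 j = sym (ℕₚ.m+[n∸m]≡n (unit-≤ i ci≢0 j))

weigh : ∀ {k} → (Fin k → ℕ) → (Fin k → ℕ) → ℕ
weigh w c = sumℕ (λ j → c j ℕ.* w j)

weigh-cong : ∀ {k} (w : Fin k → ℕ) {c d} → c ≗ d → weigh w c ≡ weigh w d
weigh-cong w c≗d = sumℕ-cong (λ j → cong (ℕ._* w j) (c≗d j))

weigh-zero : ∀ {k} (w : Fin k → ℕ) → weigh w (λ _ → 0) ≡ 0
weigh-zero {k} w = sumℕ-zero k

weigh-+ : ∀ {k} (w : Fin k → ℕ) c d → weigh w (zipWith ℕ._+_ c d) ≡ weigh w c ℕ.+ weigh w d
weigh-+ w c d = trans (sumℕ-cong (λ j → ℕₚ.*-distribʳ-+ (w j) (c j) (d j)))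
                      (sumℕ-+ (λ j → c j ℕ.* w j) (λ j → d j ℕ.* w j))

weigh-unit : ∀ {k} (w : Fin k → ℕ) i → weigh w (unit i) ≡ w i
weigh-unit {suc k} w zero    =
  trans (cong₂ ℕ._+_ (ℕₚ.*-identityˡ (w zero)) (sumℕ-zero k)) (ℕₚ.+-identityʳ (w zero))
weigh-unit         w (suc i) = weigh-unit (w ∘ suc) i

module Modular (n : ℕ) where
  toℕ-mod : ∀ a → toℕ (a mod suc n) ≡ a % suc n
  toℕ-mod a = Finₚ.toℕ-fromℕ< (m%n<n a (suc n))

  mod-cong : ∀ {a b} → a % suc n ≡ b % suc n → a mod suc n ≡ b mod suc n
  mod-cong {a} {b} a≡b = Finₚ.toℕ-injective (trans (toℕ-mod a) (trans a≡b (sym (toℕ-mod b))))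

  toℕ-% : ∀ (u : Fin (suc n)) → toℕ u % suc n ≡ toℕ u
  toℕ-% u = m<n⇒m%n≡m (Finₚ.toℕ<n u)

  toℕ-mod-inverse : ∀ (u : Fin (suc n)) → toℕ u mod suc n ≡ u
  toℕ-mod-inverse u = Finₚ.toℕ-injective (trans (toℕ-mod (toℕ u)) (toℕ-% u))

  ⊕-identityˡ : ∀ u → zero ⊕ u ≡ u
  ⊕-identityˡ = toℕ-mod-inverse

  ⊕-identityʳ : ∀ u → u ⊕ zero ≡ u
  ⊕-identityʳ u = trans (cong (_mod suc n) (ℕₚ.+-identityʳ (toℕ u))) (toℕ-mod-inverse u)

  %-cong-+ : ∀ {a a′ b b′} → a % suc n ≡ a′ % suc n → b % suc n ≡ b′ % suc n →
             (a ℕ.+ b) % suc n ≡ (a′ ℕ.+ b′) % suc n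
  %-cong-+ {a} {a′} {b} {b′} a≡a′ b≡b′ = begin
    (a ℕ.+ b) % suc n                       ≡⟨ %-distribˡ-+ a b (suc n) ⟩
    (a % suc n ℕ.+ b % suc n) % suc n       ≡⟨ cong₂ (λ x y → (x ℕ.+ y) % suc n) a≡a′ b≡b′ ⟩
    (a′ % suc n ℕ.+ b′ % suc n) % suc n     ≡⟨ %-distribˡ-+ a′ b′ (suc n) ⟨
    (a′ ℕ.+ b′) % suc n                     ∎
    where open ≡-Reasoning

  %-cong-* : ∀ {a a′} b → a % suc n ≡ a′ % suc n → (a ℕ.* b) % suc n ≡ (a′ ℕ.* b) % suc n
  %-cong-* {a} {a′} b a≡a′ = begin
    (a ℕ.* b) % suc n                       ≡⟨ %-distribˡ-* a b (suc n) ⟩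
    (a % suc n ℕ.* (b % suc n)) % suc n     ≡⟨ cong (λ x → (x ℕ.* (b % suc n)) % suc n) a≡a′ ⟩
    (a′ % suc n ℕ.* (b % suc n)) % suc n    ≡⟨ %-distribˡ-* a′ b (suc n) ⟨
    (a′ ℕ.* b) % suc n                      ∎
    where open ≡-Reasoning

  weigh-reduce : ∀ {k} (w : Fin k → ℕ) c → weigh w (λ j → c j % suc n) % suc n ≡ weigh w c % suc n
  weigh-reduce {zero}  w c = refl
  weigh-reduce {suc k} w c = %-cong-+ {c zero % suc n ℕ.* w zero} {c zero ℕ.* w zero}
    (%-cong-* {c zero % suc n} {c zero} (w zero) (m%n%n≡m%n (c zero) (suc n)))
    (weigh-reduce (w ∘ suc) (c ∘ suc))

  record Reachable {k} (w : Fin k → ℕ) (t : ℕ) : Set where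
    constructor reach
    field
      coefficients : Fin k → ℕ
      weigh≡      : weigh w coefficients % suc n ≡ t % suc n

  module _ {k : ℕ} (w : Fin k → ℕ) where

    reachable-resp : ∀ {a b} → a % suc n ≡ b % suc n → Reachable w a → Reachable w b
    reachable-resp a≡b (reach c c↦a) = reach c (trans c↦a a≡b)

    reachable-zero : Reachable w 0
    reachable-zero = reach (λ _ → 0) (cong (_% suc n) (weigh-zero w))

    reachable-+ : ∀ {a b} → Reachable w a → Reachable w b → Reachable w (a ℕ.+ b)
    reachable-+ {a} {b} (reach c c↦a) (reach d d↦b) = reach (zipWith ℕ._+_ c d)
      (trans (cong (_% suc n) (weigh-+ w c d)) (%-cong-+ {weigh w c} {a} {weigh w d} {b} c↦a d↦b))

    reachable-* : ∀ a {b} → Reachable w b → Reachable w (a ℕ.* b)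
    reachable-* zero    _  = reachable-zero
    reachable-* (suc a) rb = reachable-+ rb (reachable-* a rb)

    reachable-weight : ∀ j → Reachable w (w j)
    reachable-weight j = reach (unit j) (cong (_% suc n) (weigh-unit w j))

    -- d = a - b ≡ a + n b modulo n + 1
    reachable-difference : ∀ {a b d} → Reachable w a → Reachable w b → d ℕ.+ b ≡ a → Reachable w d
    reachable-difference {a} {b} {d} ra rb d+b≡a =
      reachable-resp a+nb≡d (reachable-+ ra (reachable-* n rb))
      where
      a+nb≡d : (a ℕ.+ n ℕ.* b) % suc n ≡ d % suc n
      a+nb≡d = begin
        (a ℕ.+ n ℕ.* b) % suc n          ≡⟨ cong (λ a → (a ℕ.+ n ℕ.* b) % suc n) d+b≡a ⟨
        (d ℕ.+ b ℕ.+ n ℕ.* b) % suc n    ≡⟨ cong (_% suc n) (shift d b n) ⟩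
        (d ℕ.+ b ℕ.* suc n) % suc n      ≡⟨ [m+kn]%n≡m%n d b (suc n) ⟩
        d % suc n                        ∎
        where
        open ≡-Reasoning
        shift : ∀ d b n → d ℕ.+ b ℕ.+ n ℕ.* b ≡ d ℕ.+ b ℕ.* suc n
        shift = solve-∀

  reachable-tail : ∀ {k} (w : Fin (suc k) → ℕ) {t} → Reachable (w ∘ suc) t → Reachable w t
  reachable-tail w (reach c c↦t) = reach (0 Vector.∷ c) c↦t

  reachable-gcd : ∀ {k} (w : Fin k → ℕ) → Reachable w (gcdAll w (suc n))
  reachable-gcd {zero}  w = reach (λ ()) (sym (n%n≡0 (suc n)))
  reachable-gcd {suc k} w = combine (Bézout.identity (gcd-GCD (w zero) G))
    where
    G = gcdAll (w ∘ suc) (suc n)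
    r₀ : Reachable w (w zero)
    r₀ = reachable-weight w zero
    rG : Reachable w G
    rG = reachable-tail w (reachable-gcd (w ∘ suc))
    combine : Bézout.Identity (gcd (w zero) G) (w zero) G → Reachable w (gcd (w zero) G)
    combine (Bézout.+- x y eq) = reachable-difference w (reachable-* w x r₀) (reachable-* w y rG) eq
    combine (Bézout.-+ x y eq) = reachable-difference w (reachable-* w y rG) (reachable-* w x r₀) eq

module Residues {n k : ℕ} (p : Fin k → Fin (suc n)) where
  open Modular n

  weights : Fin k → ℕ
  weights j = toℕ (p j)

  residue : (Fin k → ℕ) → Fin (suc n)
  residue c = weigh weights c mod suc n

  residue-cong : ∀ {c d} → c ≗ d → residue c ≡ residue d
  residue-cong c≗d = cong (_mod suc n) (weigh-cong weights c≗d)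

  toℕ-residue-% : ∀ c → toℕ (residue c) % suc n ≡ weigh weights c % suc n
  toℕ-residue-% c =
    trans (cong (_% suc n) (toℕ-mod (weigh weights c))) (m%n%n≡m%n (weigh weights c) (suc n))

  residue-+ : ∀ c d → residue (zipWith ℕ._+_ c d) ≡ residue c ⊕ residue d
  residue-+ c d = trans (cong (_mod suc n) (weigh-+ weights c d))
    (mod-cong {weigh weights c ℕ.+ weigh weights d} {toℕ (residue c) ℕ.+ toℕ (residue d)}
      (%-cong-+ {weigh weights c} {toℕ (residue c)} {weigh weights d} {toℕ (residue d)}
        (sym (toℕ-residue-% c)) (sym (toℕ-residue-% d))))

  residue-zero : residue (λ _ → 0) ≡ zero
  residue-zero = cong (_mod suc n) (weigh-zero weights)

  residue-unit : ∀ j → residue (unit j) ≡ p j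
  residue-unit j = trans (cong (_mod suc n) (weigh-unit weights j)) (toℕ-mod-inverse (p j))

  residue-reduce : ∀ c → residue (λ j → c j % suc n) ≡ residue c
  residue-reduce c =
    mod-cong {weigh weights (λ j → c j % suc n)} {weigh weights c} (weigh-reduce weights c)

  nonzero-residue⇒nonzero-entry : ∀ {c} → residue c ≢ zero → ∃ λ j → c j ≢ 0
  nonzero-residue⇒nonzero-entry {c} r≢0 = Finₚ.¬∀⟶∃¬ k (λ j → c j ≡ 0) (λ j → c j ℕ.≟ 0)
    (λ c≗0 → r≢0 (trans (residue-cong c≗0) residue-zero))

  residue-surjective : gcdAll (λ j → toℕ (p j)) (suc n) ≡ 1 → ∀ i → ∃ λ c → residue c ≡ i
  residue-surjective gcd≡1 i
    with reachable-* weights (toℕ i) (subst (Reachable weights) gcd≡1 (reachable-gcd weights))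
  ... | reach c c↦i = c , trans (mod-cong {weigh weights c} {toℕ i ℕ.* 1} c↦i)
                             (trans (cong (_mod suc n) (ℕₚ.*-identityʳ (toℕ i))) (toℕ-mod-inverse i))

vectorsBelow : ℕ → ∀ k → List (Fin k → ℕ)
vectorsBelow m zero    = (λ ()) ∷ []
vectorsBelow m (suc k) = cartesianProductWith Vector._∷_ (upTo m) (vectorsBelow m k)

vectorsBelow-complete : ∀ m {k} (c : Fin k → ℕ) → (∀ j → c j ℕ.< m) →
                        ∃ λ c′ → c′ ∈ vectorsBelow m k × c′ ≗ c
vectorsBelow-complete m {zero}  c c<m = (λ ()) , here refl , λ ()
vectorsBelow-complete m {suc k} c c<m with vectorsBelow-complete m (c ∘ suc) (c<m ∘ suc)
... | c′ , c′∈ , c′≗c = (c zero Vector.∷ c′) ,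
                        ∈-cartesianProductWith⁺ Vector._∷_ (∈-upTo⁺ (c<m zero)) c′∈ ,
                        λ { zero → refl ; (suc j) → c′≗c j }

module NaturalCombinations (ℝ : RealField) where
  open RealFieldProperties ℝ

  module _ {k : ℕ} where

    dotℕ-cong : ∀ {c d : Fin k → ℕ} (x : Fin k → R) → c ≗ d → dotℕ ℝ c x ≡ dotℕ ℝ d x
    dotℕ-cong x c≗d = sumR-cong (λ j → cong (_· x j) (c≗d j))

    dotℕ-zero : ∀ (x : Fin k → R) → dotℕ ℝ (λ _ → 0) x ≡ 0#
    dotℕ-zero x = sumR-zero k

    dotℕ-+ : ∀ (c d : Fin k → ℕ) x → dotℕ ℝ (zipWith ℕ._+_ c d) x ≡ dotℕ ℝ c x + dotℕ ℝ d x
    dotℕ-+ c d x = trans (sumR-cong (λ j → ·-distribʳ-+ (c j) (d j) (x j)))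
                         (sumR-+ (λ j → c j · x j) (λ j → d j · x j))

    dotℕ-mono-≤ : ∀ {c d : Fin k → ℕ} {x} → (∀ j → c j ℕ.≤ d j) → (∀ j → 0# ≤ x j) →
                  dotℕ ℝ c x ≤ dotℕ ℝ d x
    dotℕ-mono-≤ c≤d 0≤x = sumR-mono-≤ (λ j → ·-monoˡ-≤ (c≤d j) (0≤x j))

    dotℕ-nonneg : ∀ (c : Fin k → ℕ) {x} → (∀ j → 0# ≤ x j) → 0# ≤ dotℕ ℝ c x
    dotℕ-nonneg c 0≤x = sumR-nonneg (λ j → ·-nonneg (c j) (0≤x j))

  dotℕ-unit : ∀ {k} (i : Fin k) x → dotℕ ℝ (unit i) x ≡ x i
  dotℕ-unit {suc k} zero x = trans (cong₂ _+_ (·-identityˡ (x zero)) (sumR-zero k)) (+-identityʳ (x zero))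
  dotℕ-unit (suc i) x = trans (+-identityˡ _) (dotℕ-unit i (x ∘ suc))

  entry≤dotℕ : ∀ {k} {c : Fin k → ℕ} {x} i → c i ≢ 0 → (∀ j → 0# ≤ x j) → x i ≤ dotℕ ℝ c x
  entry≤dotℕ {c = c} {x} i ci≢0 0≤x =
    subst (_≤ dotℕ ℝ c x) (dotℕ-unit i x) (dotℕ-mono-≤ {d = c} (unit-≤ i ci≢0) 0≤x)

module KunzCone (ℝ : RealField) (n : ℕ) where
  open RealFieldProperties ℝ
  open Modular n using (⊕-identityˡ; ⊕-identityʳ)

  slack : (Fin n → R) → Fin (suc n) → Fin (suc n) → R
  slack z u v = ext ℝ z u + ext ℝ z v - ext ℝ z (u ⊕ v)

  slack≡0⇒additive : ∀ z u v → slack z u v ≡ 0# → ext ℝ z u + ext ℝ z v ≡ ext ℝ z (u ⊕ v)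
  slack≡0⇒additive z u v = x∙y⁻¹≈ε⇒x≈y _ _

  slack-zeroˡ : ∀ z v → slack z zero v ≡ 0#
  slack-zeroˡ z v = trans (cong (λ w → 0# + ext ℝ z v - ext ℝ z w) (⊕-identityˡ v))
                          (solve 2 (λ o a → o :+ a :- a := o) refl 0# (ext ℝ z v))

  slack-zeroʳ : ∀ z u → slack z u zero ≡ 0#
  slack-zeroʳ z u = trans (cong (λ w → ext ℝ z u + 0# - ext ℝ z w) (⊕-identityʳ u))
                          (solve 2 (λ a o → a :+ o :- a := o) refl (ext ℝ z u) 0#)

  slack-nonneg : ∀ {z} → InKunz ℝ z → ∀ u v → u ⊕ v ≢ zero → 0# ≤ slack z u v
  slack-nonneg {z} z∈C zero    v       _ = reflexive (sym (slack-zeroˡ z v))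
  slack-nonneg {z} z∈C (suc i) zero    _ = reflexive (sym (slack-zeroʳ z (suc i)))
  slack-nonneg     z∈C (suc i) (suc j) h = x≤y⇒0≤y-x (z∈C i j h)

  extend : (Fin n → R) → (Fin n → R) → R → Fin n → R
  extend y z ε j = y j + ε * (y j - z j)

  slack-extend : ∀ y z ε u v →
                 slack (extend y z ε) u v ≡ slack y u v + ε * (slack y u v - slack z u v)
  slack-extend y z ε u v = begin
    slack (extend y z ε) u v
      ≡⟨ cong₂ _+_ (cong₂ _+_ (ext-extend u) (ext-extend v)) (cong -_ (ext-extend (u ⊕ v))) ⟩
    (Y u + ε * (Y u - Z u)) + (Y v + ε * (Y v - Z v)) - (Y (u ⊕ v) + ε * (Y (u ⊕ v) - Z (u ⊕ v)))
      ≡⟨ solve 7 (λ a b c a′ b′ c′ e →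
                    (a :+ e :* (a :- a′)) :+ (b :+ e :* (b :- b′)) :- (c :+ e :* (c :- c′))
                    := (a :+ b :- c) :+ e :* ((a :+ b :- c) :- (a′ :+ b′ :- c′)))
               refl (Y u) (Y v) (Y (u ⊕ v)) (Z u) (Z v) (Z (u ⊕ v)) ε ⟩
    slack y u v + ε * (slack y u v - slack z u v)
      ∎
    where
    open ≡-Reasoning
    Y Z : Fin (suc n) → R
    Y = ext ℝ y
    Z = ext ℝ z
    ext-extend : ∀ r → ext ℝ (extend y z ε) r ≡ Y r + ε * (Y r - Z r)
    ext-extend zero    = sym (x+δ[x-x]≡x 0# ε)
    ext-extend (suc i) = refl

  dot-zeroˡ : ∀ (z : Fin n → R) → dot ℝ (λ _ → 0#) z ≡ 0#
  dot-zeroˡ z = sumR-vanishing (λ l → zeroˡ (z l))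

  coordinate : Fin (suc n) → Fin n → R
  coordinate r l = ext ℝ (λ i → kronecker i l) r

  dot-coordinate : ∀ r z → dot ℝ (coordinate r) z ≡ ext ℝ z r
  dot-coordinate zero    z = dot-zeroˡ z
  dot-coordinate (suc i) z = sumR-kronecker i z

  slackForm : Fin (suc n) → Fin (suc n) → Fin n → R
  slackForm u v l = coordinate u l + coordinate v l - coordinate (u ⊕ v) l

  dot-slackForm : ∀ u v z → dot ℝ (slackForm u v) z ≡ slack z u v
  dot-slackForm u v z = begin
    sumR ℝ (λ l → (U l + V l - W l) * z l)
      ≡⟨ sumR-cong (λ l → solve 4 (λ a b c x → (a :+ b :- c) :* x := a :* x :+ b :* x :- c :* x)
                                  refl (U l) (V l) (W l) (z l)) ⟩
    sumR ℝ (λ l → U l * z l + V l * z l - W l * z l)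
      ≡⟨ trans (sumR-+ (λ l → U l * z l + V l * z l) (λ l → - (W l * z l)))
               (cong₂ _+_ (sumR-+ (λ l → U l * z l) (λ l → V l * z l)) (sumR-neg (λ l → W l * z l))) ⟩
    dot ℝ U z + dot ℝ V z - dot ℝ W z
      ≡⟨ cong₂ _-_ (cong₂ _+_ (dot-coordinate u z) (dot-coordinate v z)) (dot-coordinate (u ⊕ v) z) ⟩
    slack z u v
      ∎
    where
    open ≡-Reasoning
    U V W : Fin n → R
    U = coordinate u
    V = coordinate v
    W = coordinate (u ⊕ v)

  dot-sumˡ : ∀ {N} (f : Fin N → Fin n → R) z →
             dot ℝ (λ l → sumR ℝ (λ i → f i l)) z ≡ sumR ℝ (λ i → dot ℝ (f i) z)
  dot-sumˡ f z = trans (sumR-cong (λ l → sumR-*ʳ (λ i → f i l) (z l)))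
                       (sumR-comm (λ l i → f i l * z l))

  module TightFace (y : Fin n → R) (y∈C : InKunz ℝ y) where

    Tight : Fin (suc n) → Fin (suc n) → Set
    Tight u v = u ⊕ v ≢ zero × slack y u v ≡ 0#

    tight? : ∀ u v → Dec (Tight u v)
    tight? u v = ¬? (u ⊕ v Fin.≟ zero) ×-dec (slack y u v ≟ 0#)

    tightForm : Fin (suc n) → Fin (suc n) → Fin n → R
    tightForm u v with tight? u v
    ... | yes _ = slackForm u v
    ... | no _  = λ _ → 0#

    normal : Fin n → R
    normal l = sumR ℝ (λ u → sumR ℝ (λ v → tightForm u v l))

    dot-normal : ∀ z → dot ℝ normal z ≡ sumR ℝ (λ u → sumR ℝ (λ v → dot ℝ (tightForm u v) z))
    dot-normal z = trans (dot-sumˡ (λ u l → sumR ℝ (λ v → tightForm u v l)) z)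
                         (sumR-cong (λ u → dot-sumˡ (tightForm u) z))

    tightForm-nonneg : ∀ {z} → InKunz ℝ z → ∀ u v → 0# ≤ dot ℝ (tightForm u v) z
    tightForm-nonneg {z} z∈C u v with tight? u v
    ... | yes (u⊕v≢0 , _) = subst (0# ≤_) (sym (dot-slackForm u v z)) (slack-nonneg z∈C u v u⊕v≢0)
    ... | no _            = reflexive (sym (dot-zeroˡ z))

    tightForm-tight : ∀ {z} u v → Tight u v → dot ℝ (tightForm u v) z ≡ slack z u v
    tightForm-tight {z} u v t with tight? u v
    ... | yes _ = dot-slackForm u v z
    ... | no ¬t = contradiction t ¬t

    tightForm-vanishing : ∀ {z} → (∀ u v → Tight u v → slack z u v ≡ 0#) →
                          ∀ u v → dot ℝ (tightForm u v) z ≡ 0#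
    tightForm-vanishing {z} tight⇒0 u v with tight? u v
    ... | yes t = trans (dot-slackForm u v z) (tight⇒0 u v t)
    ... | no _  = dot-zeroˡ z

    normal-supporting : IsSupporting ℝ normal
    normal-supporting z z∈C = subst (0# ≤_) (sym (dot-normal z))
      (sumR-nonneg (λ u → sumR-nonneg (tightForm-nonneg z∈C u)))

    face⇒tight : ∀ {z} → InFace ℝ normal z → ∀ u v → Tight u v → slack z u v ≡ 0#
    face⇒tight {z} (z∈C , normal·z≡0) u v t = trans (sym (tightForm-tight u v t)) (row-zero v)
      where
      row-zero = sumR-nonneg-zero (tightForm-nonneg z∈C u)
        (sumR-nonneg-zero (λ u → sumR-nonneg (tightForm-nonneg z∈C u))
                          (trans (sym (dot-normal z)) normal·z≡0) u)

    tight⇒face : ∀ {z} → InKunz ℝ z → (∀ u v → Tight u v → slack z u v ≡ 0#) → InFace ℝ normal z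
    tight⇒face {z} z∈C tight⇒0 = z∈C , trans (dot-normal z)
      (sumR-vanishing (λ u → sumR-vanishing (tightForm-vanishing tight⇒0 u)))

    y∈face : InFace ℝ normal y
    y∈face = tight⇒face y∈C (λ _ _ → proj₂)

    tight⇒defined : ∀ u v → Tight u v → NAdd ℝ normal (just u) (just v) (just (u ⊕ v))
    tight⇒defined u v t = defined u v (λ z z∈F → slack≡0⇒additive z u v (face⇒tight z∈F u v t))

    positive⇒trivial-subgroup : (∀ i → 0# < y i) → TrivialKunzSubgroup ℝ normal
    positive⇒trivial-subgroup 0<y i vanishing = proj₂ (0<y i) (sym (vanishing y y∈face))

    module Extension {z : Fin n → R} (z∈F : InFace ℝ normal z) where

      step-bound : ∀ u v → ∃ λ ε → 0# < ε ×
        (u ⊕ v ≢ zero → ∀ δ → 0# ≤ δ → δ ≤ ε → 0# ≤ slack y u v + δ * (slack y u v - slack z u v))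
      step-bound u v with u ⊕ v Fin.≟ zero
      ... | yes u⊕v≡0 = 1# , 0<1 , λ u⊕v≢0 → contradiction u⊕v≡0 u⊕v≢0
      ... | no u⊕v≢0 with affine-step (slack-nonneg y∈C u v u⊕v≢0) (slack-nonneg (proj₁ z∈F) u v u⊕v≢0)
                                      (λ s≡0 → face⇒tight z∈F u v (u⊕v≢0 , s≡0))
      ...   | ε , 0<ε , nonneg = ε , 0<ε , λ _ → nonneg

      bound = finite-lower-bound₂ (λ u v → proj₁ (step-bound u v))
                                  (λ u v → proj₁ (proj₂ (step-bound u v)))

      ε : R
      ε = proj₁ bound

      0<ε : 0# < ε
      0<ε = proj₁ (proj₂ bound)

      extension∈C : InKunz ℝ (extend y z ε)
      extension∈C i j h = 0≤y-x⇒x≤y (subst (0# ≤_) (sym (slack-extend y z ε (suc i) (suc j)))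
        (proj₂ (proj₂ (step-bound (suc i) (suc j))) h ε (proj₁ 0<ε)
                                                    (proj₂ (proj₂ bound) (suc i) (suc j))))

      extension∈face : InFace ℝ normal (extend y z ε)
      extension∈face = tight⇒face extension∈C λ u v t → begin
        slack (extend y z ε) u v                       ≡⟨ slack-extend y z ε u v ⟩
        slack y u v + ε * (slack y u v - slack z u v)  ≡⟨ cong₂ (λ s t → s + ε * (s - t))
                                                                 (proj₂ t) (face⇒tight z∈F u v t) ⟩
        0# + ε * (0# - 0#)                             ≡⟨ x+δ[x-x]≡x 0# ε ⟩
        0#                                             ∎
        where open ≡-Reasoning

    y∈relint : InRelint ℝ normal y
    y∈relint = y∈face , λ z z∈F → let open Extension z∈F in ε , 0<ε , extension∈face

module CmA (ℝ : RealField) {n k : ℕ} (p : Fin k → Fin (suc n)) where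
  open RealFieldProperties ℝ
  open NaturalCombinations ℝ
  open Residues p

  module Interior {x : Fin k → R} (x∈int : InteriorCmA ℝ p x) where

    ε : R
    ε = proj₁ x∈int

    0<ε : 0# < ε
    0<ε = proj₁ (proj₂ x∈int)

    near⇒∈C : ∀ z → (∀ j → ∃ λ d → z j ≡ x j + d × - ε < d × d < ε) → InCmA ℝ p z
    near⇒∈C z near = proj₂ (proj₂ x∈int) z λ j → let d , z≡x+d , -ε<d , d<ε = near j in
      subst (λ w → x j - ε < w × w < x j + ε) (sym z≡x+d)
            (+-monoʳ-< (x j) -ε<d , +-monoʳ-< (x j) d<ε)

    x∈C : InCmA ℝ p x
    x∈C = near⇒∈C x (λ j → 0# , sym (+-identityʳ (x j)) , pos⇒-neg 0<ε , 0<ε)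

    δ : R
    δ = proj₁ (positive-below 0<ε)

    0<δ : 0# < δ
    0<δ = proj₁ (proj₂ (positive-below 0<ε))

    δ<ε : δ < ε
    δ<ε = proj₂ (proj₂ (positive-below 0<ε))

    x-pos : ∀ j → 0# < x j
    x-pos j = begin-strict
      0#               <⟨ 0<δ ⟩
      δ                ≤⟨ 0≤y-x⇒x≤y (subst (0# ≤_) (+-comm (- δ) (x j)) (proj₁ lowered∈C j)) ⟩
      x j              ∎
      where
      open ≤-Reasoning
      lowered∈C : InCmA ℝ p (λ l → - δ + x l)
      lowered∈C = near⇒∈C _ λ l →
        - δ , +-comm (- δ) (x l) , neg-antimono-< δ<ε , <-trans (pos⇒-neg 0<δ) 0<ε

    -- Raising x j alone stays in the cone, so the inequality x j ≤ c · x for p j has slack.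
    generator-strict : ∀ c j → residue c ≡ p j → c j ≡ 0 → x j < dotℕ ℝ c x
    generator-strict c j c↦pj cj≡0 = begin-strict
      x j                  <⟨ x<x+y (x j) 0<δ ⟩
      x j + δ              ≡⟨ updateAt-updates j x ⟨
      raised j             ≤⟨ proj₂ raised∈C j c c↦pj ⟩
      dotℕ ℝ c raised      ≡⟨ sumR-cong unaffected ⟩
      dotℕ ℝ c x           ∎
      where
      open ≤-Reasoning
      raised : Fin k → R
      raised = updateAt x j (_+ δ)
      near : ∀ l → ∃ λ d → raised l ≡ x l + d × - ε < d × d < ε
      near l with l Fin.≟ j
      ... | yes refl = δ , updateAt-updates j x , <-trans (pos⇒-neg 0<ε) 0<δ , δ<ε
      ... | no l≢j   =
        0# , trans (updateAt-minimal l j x l≢j) (sym (+-identityʳ (x l))) , pos⇒-neg 0<ε , 0<ε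
      raised∈C : InCmA ℝ p raised
      raised∈C = near⇒∈C raised near
      unaffected : ∀ l → c l · raised l ≡ c l · x l
      unaffected l with l Fin.≟ j
      ... | yes refl = trans (cong (_· raised j) cj≡0) (sym (cong (_· x j) cj≡0))
      ... | no l≢j   = cong (c l ·_) (updateAt-minimal l j x l≢j)

  module Minimal {x : Fin k → R} (0≤x : ∀ j → 0# ≤ x j) where
    open Extrema totalOrder using (argmin; argmin-all; f[argmin]≤f[xs])

    cost : (Fin k → ℕ) → R
    cost c = dotℕ ℝ c x

    -- Reducing coefficients modulo m keeps the residue and lowers the cost,
    -- so finitely many candidates suffice.
    candidates : Fin (suc n) → List (Fin k → ℕ)
    candidates i = filter (λ c → residue c Fin.≟ i) (vectorsBelow (suc n) k)

    minimal-representation : ∀ {i} c₀ → residue c₀ ≡ i →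
                             ∃ λ c → residue c ≡ i × (∀ d → residue d ≡ i → cost c ≤ cost d)
    minimal-representation {i} c₀ c₀↦i =
      best , argmin-all cost c₀↦i (all-filter (λ c → residue c Fin.≟ i) (vectorsBelow (suc n) k)) ,
      best≤
      where
      best = argmin cost c₀ (candidates i)
      best≤ : ∀ d → residue d ≡ i → cost best ≤ cost d
      best≤ d d↦i with vectorsBelow-complete (suc n) (λ j → d j % suc n) (λ j → m%n<n (d j) (suc n))
      ... | d′ , d′∈ , d′≗d%m = begin
        cost best                      ≤⟨ All.lookup (f[argmin]≤f[xs] c₀ (candidates i)) d′∈candidates ⟩
        cost d′                        ≡⟨ dotℕ-cong x d′≗d%m ⟩
        cost (λ j → d j % suc n)       ≤⟨ dotℕ-mono-≤ (λ j → m%n≤m (d j) (suc n)) 0≤x ⟩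
        cost d                         ∎
        where
        open ≤-Reasoning
        d′∈candidates : d′ ∈ candidates i
        d′∈candidates = ∈-filter⁺ (λ c → residue c Fin.≟ i) d′∈
          (trans (residue-cong d′≗d%m) (trans (residue-reduce d) d↦i))

    q-exists : gcdAll (λ j → toℕ (p j)) (suc n) ≡ 1 → Σ (Fin n → R) (IsQ ℝ p x)
    q-exists gcd≡1 = (λ j → cost (proj₁ (minimal (suc j)))) , λ j →
      let c , c↦j , c-minimal = minimal (suc j) in (c , c↦j , refl) , c-minimal
      where
      minimal : ∀ i → ∃ λ c → residue c ≡ i × (∀ d → residue d ≡ i → cost c ≤ cost d)
      minimal i = let c₀ , c₀↦i = residue-surjective gcd≡1 i in minimal-representation c₀ c₀↦i

  module QImage {x : Fin k → R} (x∈int : InteriorCmA ℝ p x)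
                {y : Fin n → R} (y≡q[x] : IsQ ℝ p x y) where
    open Interior x∈int
    open Modular n using (⊕-identityʳ)
    open KunzCone ℝ n using (slack; module TightFace)

    Y : Fin (suc n) → R
    Y = ext ℝ y

    representation : ∀ r → ∃ λ c → residue c ≡ r × dotℕ ℝ c x ≡ Y r
    representation zero    = (λ _ → 0) , residue-zero , dotℕ-zero x
    representation (suc i) = proj₁ (y≡q[x] i)

    Y-minimal : ∀ r c → residue c ≡ r → Y r ≤ dotℕ ℝ c x
    Y-minimal zero    c _ = dotℕ-nonneg c (proj₁ x∈C)
    Y-minimal (suc i) c   = proj₂ (y≡q[x] i) c

    Y-subadditive : ∀ u v → Y (u ⊕ v) ≤ Y u + Y v
    Y-subadditive u v with representation u | representation v
    ... | cu , cu↦u , cu≡Yu | cv , cv↦v , cv≡Yv =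
      subst (Y (u ⊕ v) ≤_) (trans (dotℕ-+ cu cv x) (cong₂ _+_ cu≡Yu cv≡Yv))
        (Y-minimal (u ⊕ v) (zipWith ℕ._+_ cu cv) (trans (residue-+ cu cv) (cong₂ _⊕_ cu↦u cv↦v)))

    y∈C : InKunz ℝ y
    y∈C i j _ = Y-subadditive (suc i) (suc j)

    Y-pos : ∀ r → r ≢ zero → 0# < Y r
    Y-pos r r≢0 = let c , c↦r , c≡Yr = representation r
                      j , cj≢0 = nonzero-residue⇒nonzero-entry {c} (r≢0 ∘ trans (sym c↦r)) in begin-strict
      0#          <⟨ x-pos j ⟩
      x j         ≤⟨ entry≤dotℕ {c = c} j cj≢0 (proj₁ x∈C) ⟩
      dotℕ ℝ c x  ≡⟨ c≡Yr ⟩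
      Y r         ∎
      where open ≤-Reasoning

    y-pos : ∀ i → 0# < y i
    y-pos i = Y-pos (suc i) (λ ())

    Y-generator : ∀ j → Y (p j) ≡ x j
    Y-generator j = let c , c↦pj , c≡Ypj = representation (p j) in
      antisym (subst (Y (p j) ≤_) (dotℕ-unit j x) (Y-minimal (p j) (unit j) (residue-unit j)))
              (subst (x j ≤_) c≡Ypj (proj₂ x∈C j c c↦pj))

    optimal-split : ∀ {r c} j → residue c ≡ r → dotℕ ℝ c x ≡ Y r → c j ≢ 0 →
                    r ≡ p j ⊕ residue (decrement c j) × slack y (p j) (residue (decrement c j)) ≡ 0#
    optimal-split {r} {c} j c↦r c≡Yr cj≢0 =
      r≡pj⊕v , trans (cong (_- Y (p j ⊕ v)) additive) (-‿inverseʳ _)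
      where
      c′ = decrement c j
      v = residue c′
      r≡pj⊕v : r ≡ p j ⊕ v
      r≡pj⊕v = begin
        r                            ≡⟨ c↦r ⟨
        residue c                    ≡⟨ residue-cong (unit-split j cj≢0) ⟩
        residue (zipWith ℕ._+_ (unit j) c′) ≡⟨ residue-+ (unit j) c′ ⟩
        residue (unit j) ⊕ v         ≡⟨ cong (_⊕ v) (residue-unit j) ⟩
        p j ⊕ v                      ∎
        where open ≡-Reasoning
      additive : Y (p j) + Y v ≡ Y (p j ⊕ v)
      additive = antisym (begin
        Y (p j) + Y v                       ≤⟨ +-mono-≤ (reflexive (Y-generator j)) (Y-minimal v c′ refl) ⟩
        x j + dotℕ ℝ c′ x                   ≡⟨ cong (_+ dotℕ ℝ c′ x) (dotℕ-unit j x) ⟨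
        dotℕ ℝ (unit j) x + dotℕ ℝ c′ x     ≡⟨ dotℕ-+ (unit j) c′ x ⟨
        dotℕ ℝ (zipWith ℕ._+_ (unit j) c′) x ≡⟨ dotℕ-cong x (unit-split j cj≢0) ⟨
        dotℕ ℝ c x                          ≡⟨ trans c≡Yr (cong Y r≡pj⊕v) ⟩
        Y (p j ⊕ v)                         ∎) (Y-subadditive (p j) v)
        where open ≤-Reasoning

    generator-untight : ∀ j u v → u ≢ zero → v ≢ zero → u ⊕ v ≡ p j → Y u + Y v ≢ Y (u ⊕ v)
    generator-untight j u v u≢0 v≢0 u⊕v≡pj additive with representation u | representation v
    ... | cu , cu↦u , cu≡Yu | cv , cv↦v , cv≡Yv = exceeded (cu j ℕ.≟ 0)
      where
      sum≡xj : Y u + Y v ≡ x j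
      sum≡xj = trans additive (trans (cong Y u⊕v≡pj) (Y-generator j))
      cj≢0 : cu j ℕ.+ cv j ≢ 0
      cj≢0 cj≡0 = <-irrefl (sym (trans (dotℕ-+ cu cv x) (trans (cong₂ _+_ cu≡Yu cv≡Yv) sum≡xj)))
        (generator-strict (zipWith ℕ._+_ cu cv) j
          (trans (residue-+ cu cv) (trans (cong₂ _⊕_ cu↦u cv↦v) u⊕v≡pj)) cj≡0)
      exceeds : ∀ c {a b} → c j ≢ 0 → dotℕ ℝ c x ≡ a → 0# < b → x j < a + b
      exceeds c {a} {b} cj≢0 c≡a 0<b = begin-strict
        x j         ≤⟨ entry≤dotℕ {c = c} j cj≢0 (proj₁ x∈C) ⟩
        dotℕ ℝ c x  ≡⟨ c≡a ⟩
        a           <⟨ x<x+y a 0<b ⟩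
        a + b       ∎
        where open ≤-Reasoning
      exceeded : Dec (cu j ≡ 0) → ⊥
      exceeded (no cuj≢0)  = <-irrefl (sym sum≡xj) (exceeds cu cuj≢0 cu≡Yu (Y-pos v v≢0))
      exceeded (yes cuj≡0) = <-irrefl (sym (trans (+-comm (Y v) (Y u)) sum≡xj))
        (exceeds cv (λ cvj≡0 → cj≢0 (cong₂ ℕ._+_ cuj≡0 cvj≡0)) cv≡Yv (Y-pos u u≢0))

    open TightFace y y∈C public using (normal; normal-supporting; y∈relint; positive⇒trivial-subgroup)
    open TightFace y y∈C using (y∈face; tight⇒defined)

    module Atoms (p≢0 : ∀ j → p j ≢ zero) where

      atom⇒generator : ∀ w → IsAtom ℝ normal w → ∃ λ j → w ≡ just (p j)
      atom⇒generator nothing  (_ , indecomposable) =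
        ⊥-elim (indecomposable (nothing , nothing , (λ ()) , (λ ()) , ∞ˡ nothing))
      atom⇒generator (just r) (r≢0 , indecomposable) with representation r
      ... | c , c↦r , c≡Yr = split-off (v Fin.≟ zero)
        where
        r≢zero : r ≢ zero
        r≢zero = r≢0 ∘ cong just
        entry = nonzero-residue⇒nonzero-entry {c} (r≢zero ∘ trans (sym c↦r))
        j = proj₁ entry
        v = residue (decrement c j)
        split = optimal-split j c↦r c≡Yr (proj₂ entry)
        split-off : Dec (v ≡ zero) → ∃ λ j → just r ≡ just (p j)
        split-off (yes v≡0) =
          j , cong just (trans (proj₁ split) (trans (cong (p j ⊕_) v≡0) (⊕-identityʳ (p j))))
        split-off (no v≢0)  = ⊥-elim (indecomposable (just (p j) , just v ,
          p≢0 j ∘ Maybe.just-injective , v≢0 ∘ Maybe.just-injective ,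
          subst (λ w → NAdd ℝ normal (just (p j)) (just v) (just w)) (sym (proj₁ split))
                (tight⇒defined (p j) v (r≢zero ∘ trans (proj₁ split) , proj₂ split))))

      generator⇒atom : ∀ j → IsAtom ℝ normal (just (p j))
      generator⇒atom j = p≢0 j ∘ Maybe.just-injective ,
                         λ { (u , v , u≢0 , v≢0 , u+v) → no-decomposition u≢0 v≢0 u+v refl }
        where
        no-decomposition : ∀ {u v w} → u ≢ just zero → v ≢ just zero →
                           NAdd ℝ normal u v w → w ≢ just (p j)
        no-decomposition u≢0 v≢0 (defined u v additive) u⊕v≡pj = generator-untight j u v
          (u≢0 ∘ cong just) (v≢0 ∘ cong just) (Maybe.just-injective u⊕v≡pj) (additive y y∈face)
        no-decomposition _ _ (undefined _ _ _) ()
        no-decomposition _ _ (∞ˡ _)          ()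
        no-decomposition _ _ (∞ʳ _)          ()

      atoms : ∀ w → IsAtom ℝ normal w ⇔ ∃ λ j → w ≡ just (p j)
      atoms w = mk⇔ (atom⇒generator w) λ { (j , refl) → generator⇒atom j }

open import Data.Nat using (_≤_)

lemma3p7 : (ℝ : RealField) (n : ℕ) → 1 ≤ n →
    (k : ℕ) (p : Fin k → Fin (suc n)) →
    Injective _≡_ _≡_ p → (∀ j → p j ≢ zero) →
    gcdAll (λ j → toℕ (p j)) (suc n) ≡ 1 →
    (x : Fin k → RealField.R ℝ) → InteriorCmA ℝ p x →
    Σ (Fin n → RealField.R ℝ) (IsQ ℝ p x) ×
    (∀ y → IsQ ℝ p x y →
      Σ (Fin n → RealField.R ℝ) (λ a →
        IsSupporting ℝ a × InRelint ℝ a y × TrivialKunzSubgroup ℝ a ×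
        (∀ w → IsAtom ℝ a w ⇔ Σ (Fin k) (λ j → w ≡ just (p j)))))
lemma3p7 ℝ n _ k p _ p≢0 gcd≡1 x x∈int =
  Minimal.q-exists (proj₁ x∈C) gcd≡1 ,
  λ y y≡q[x] → let open QImage x∈int y≡q[x] in
    normal , normal-supporting , y∈relint , positive⇒trivial-subgroup y-pos , Atoms.atoms p≢0
  where
  open CmA ℝ p
  open Interior x∈int using (x∈C)
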